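{- For every positive integer $d$, the class of finite posets of Dushnik–Miller dimension at most $d$ has the Ramsey Property.
   Context: A class $\mathcal{C}$ of posets has the Ramsey Property if for every $P\in\mathcal{C}$ and every positive integer $r$ there is $Q\in\mathcal{C}$ such that for every coloring of the set of pairs $\{(a,b): a<b \text{ in } Q\}$ with $r$ colors, there is a subset $Q'$ of $Q$ whose induced subposet is isomorphic to $P$ and all pairs $(a,b)$ with $a<b$ in $Q'$ receive the same color. -}

module Defs where

open import Data.Nat using (ℕ; _<_)
open import Data.Fin using (Fin)
open import Data.Product using (Σ; ∃-syntax; _×_; _,_; proj₁)
open import Function.Bundles using (_⇔_)
open import Function.Definitions using (Injective)
open import Relation.Binary.PropositionalEquality using (_≡_)
open import Relation.Binary.Structures using (IsStrictPartialOrder)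

record FinPoset : Set₁ where
  field
    size   : ℕ
    _≺_    : Fin size → Fin size → Set
    isSPO  : IsStrictPartialOrder _≡_ _≺_

open FinPoset public

Class : Set₁
Class = FinPoset → Set

-- A linear order on Fin n, given by an injective ranking into ℕ
-- (x is below y in the linear order iff rank x < rank y).
LinearOrder : ℕ → Set
LinearOrder n = Σ (Fin n → ℕ) λ rk → Injective _≡_ _≡_ rk

-- Dushnik–Miller dimension at most d: there is a family of d linear
-- orders (repetitions allowed) whose intersection is P.
-- (The ⇒ direction makes each of them a linear extension of P.)
DimAtMost : ℕ → FinPoset → Set
DimAtMost d P =
  Σ (Fin d → LinearOrder (size P)) λ L →
    (x y : Fin (size P)) →
      (_≺_ P x y) ⇔ ((i : Fin d) → proj₁ (L i) x < proj₁ (L i) y)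

Embedding : FinPoset → FinPoset → Set
Embedding P Q =
  Σ (Fin (size P) → Fin (size Q)) λ e →
    Injective _≡_ _≡_ e ×
    ((x y : Fin (size P)) → (_≺_ P x y) ⇔ (_≺_ Q (e x) (e y)))

-- Ramsey property: colorings of the comparable pairs (a,b), a < b in Q,
-- with r colors are represented by functions Fin |Q| → Fin |Q| → Fin r
-- (only values at comparable pairs matter).
RamseyProperty : Class → Set₁
RamseyProperty C =
  (P : FinPoset) → C P → (r : ℕ) → 0 < r →
    Σ FinPoset λ Q → C Q ×
      ((c : Fin (size Q) → Fin (size Q) → Fin r) →
        Σ (Embedding P Q) λ emb →
          ∃[ k ] ((x y : Fin (size P)) → _≺_ P x y →
                    c (proj₁ emb x) (proj₁ emb y) ≡ k))

-- A poset P of dimension d is the intersection of d linear orders, so ranking its points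
-- in each of them places P inside a grid [n]^d, ordered coordinatewise, with distinct
-- points differing in every coordinate. The product Ramsey theorem for pairs (by induction
-- on d from Ramsey's theorem) yields N such that every r-colouring of the coordinatewise
-- increasing pairs of [N]^d is constant on the image of some product of increasing maps
-- [n] → [N]. Order [N]^d by the d linear orders "coordinate i, ties broken by the point
-- itself": this Q has dimension d, and on points differing in every coordinate it is the
-- coordinatewise order, so the image of P is a monochromatic copy of P in Q.

module Submission where

open import Data.Empty using (⊥-elim)
open import Data.Fin as Fin using (Fin; zero; suc; toℕ; inject≤; fromℕ<; combine; funToFin; finToFun)
open import Data.Fin.Properties using (toℕ-inject≤; toℕ-fromℕ<; toℕ-injective; combine-monoˡ-<; combine-injectiveʳ; finToFun-funToFin)
import Data.Fin.Properties as Finₚ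
open import Data.List as List using (List; []; _∷_; length; filter; allFin)
open import Data.List.Membership.Propositional.Properties using (∈-lookup)
open import Data.List.Properties using (length-tabulate)
open import Data.List.Relation.Binary.Sublist.Propositional using (_⊆_; []; _∷_; _∷ʳ_; ⊆-refl; ⊆-trans; minimum)
open import Data.List.Relation.Binary.Sublist.Propositional.Properties using (All-resp-⊆; filter-⊆)
open import Data.List.Relation.Unary.All as All using (All)
open import Data.List.Relation.Unary.All.Properties using (all-filter)
open import Data.List.Relation.Unary.AllPairs as AllPairs using (AllPairs; []; _∷_)
open import Data.List.Relation.Unary.AllPairs.Properties using (tabulate⁺-<)
open import Data.Nat using (ℕ; zero; suc; _+_; _^_; _⊔_; _≤_; _<_; z≤n; s≤s; NonZero; >-nonZero)
open import Data.Nat.Properties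
open import Data.Product using (Σ; ∃; ∃₂; _×_; _,_; proj₁; proj₂)
open import Data.Sum as Sum using (_⊎_; inj₁; inj₂)
open import Relation.Binary.PropositionalEquality
open import Relation.Nullary using (Dec; yes; no; ¬_; ¬?)
open import Relation.Binary.Core using (_Preserves_⟶_)
open import Relation.Binary.Definitions using (tri<; tri≈; tri>)
open import Function using (id; _∘_)
open import Function.Definitions using (Injective)
open import Function.Bundles using (_⇔_; mk⇔; Equivalence)

open import Data.Vec as Vec using (Vec; []; _∷_)
open import Data.Vec.Properties using (tabulate-cong; tabulate∘lookup; lookup∘tabulate; tabulate-∘)
open import Data.Vec.Relation.Binary.Pointwise.Inductive as Pointwise using (Pointwise; []; _∷_)

open import Defs

-- Ramsey's theorem for pairs

HomogeneousSublist : {A : Set} → (A → A → Set) → ℕ → List A → Set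
HomogeneousSublist R a xs = ∃ λ ys → ys ⊆ xs × a ≤ length ys × AllPairs R ys

module _ {A : Set} {R : A → A → Set} where

  AllPairs-resp-⊆ : ∀ {xs ys} → xs ⊆ ys → AllPairs R ys → AllPairs R xs
  AllPairs-resp-⊆ [] [] = []
  AllPairs-resp-⊆ (y ∷ʳ τ) (_ ∷ pys) = AllPairs-resp-⊆ τ pys
  AllPairs-resp-⊆ (refl ∷ τ) (px ∷ pys) = All-resp-⊆ τ px ∷ AllPairs-resp-⊆ τ pys

  AllPairs-lookup : ∀ {xs} → AllPairs R xs → ∀ {i j} → i Fin.< j → R (List.lookup xs i) (List.lookup xs j)
  AllPairs-lookup (px ∷ _) {zero} {suc j} _ = All.lookup px (∈-lookup j)
  AllPairs-lookup (_ ∷ pxs) {suc i} {suc j} (s≤s i<j) = AllPairs-lookup pxs i<j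

  AllPairs-universal : (∀ x y → R x y) → ∀ xs → AllPairs R xs
  AllPairs-universal R-all [] = []
  AllPairs-universal R-all (x ∷ xs) = All.universal (R-all x) xs ∷ AllPairs-universal R-all xs

  homogeneous-cons : ∀ {a x xs zs} → zs ⊆ xs → All (R x) zs →
                     HomogeneousSublist R a zs → HomogeneousSublist R (suc a) (x ∷ xs)
  homogeneous-cons zs⊆xs Rx (ys , ys⊆zs , a≤ , hom) =
    _ , refl ∷ ⊆-trans ys⊆zs zs⊆xs , s≤s a≤ , All-resp-⊆ ys⊆zs Rx ∷ hom

  homogeneous-skip : ∀ {a x xs zs} → zs ⊆ xs → HomogeneousSublist R a zs → HomogeneousSublist R a (x ∷ xs)
  homogeneous-skip zs⊆xs (ys , ys⊆zs , a≤ , hom) = ys , _ ∷ʳ ⊆-trans ys⊆zs zs⊆xs , a≤ , hom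

length-filter+length-filter-¬ : ∀ {A : Set} {P : A → Set} (P? : ∀ x → Dec (P x)) xs →
  length (filter P? xs) + length (filter (λ x → ¬? (P? x)) xs) ≡ length xs
length-filter+length-filter-¬ P? [] = refl
length-filter+length-filter-¬ P? (x ∷ xs) with P? x
... | yes _ = cong suc (length-filter+length-filter-¬ P? xs)
... | no _ = trans (+-suc _ _) (cong suc (length-filter+length-filter-¬ P? xs))

+-≤-split : ∀ {a b f g} → a + b ≤ f + g → a ≤ f ⊎ b ≤ g
+-≤-split {a} {b} {f} {g} le with a ≤? f | b ≤? g
... | yes a≤f | _ = inj₁ a≤f
... | no _ | yes b≤g = inj₂ b≤g
... | no a≰f | no b≰g = ⊥-elim (<⇒≱ (+-mono-< (≰⇒> a≰f) (≰⇒> b≰g)) le)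

ramseyBound : ℕ → ℕ → ℕ
ramseyBound zero b = 0
ramseyBound (suc a) zero = 0
ramseyBound (suc a) (suc b) = suc (ramseyBound a (suc b) + ramseyBound (suc a) b)

ramsey₂ : ∀ {A : Set} {R : A → A → Set} → (∀ x y → Dec (R x y)) →
          ∀ a b xs → ramseyBound a b ≤ length xs →
          HomogeneousSublist R a xs ⊎ HomogeneousSublist (λ x y → ¬ R x y) b xs
ramsey₂ R? zero b xs _ = inj₁ ([] , minimum xs , z≤n , [])
ramsey₂ R? (suc a) zero xs _ = inj₂ ([] , minimum xs , z≤n , [])
ramsey₂ R? (suc a) (suc b) (x ∷ xs) (s≤s bound≤)
  with +-≤-split (subst (_ ≤_) (sym (length-filter+length-filter-¬ (R? x) xs)) bound≤)
... | inj₁ enough = Sum.map (homogeneous-cons Rx⊆xs (all-filter (R? x) xs)) (homogeneous-skip Rx⊆xs)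
                            (ramsey₂ R? a (suc b) _ enough)
  where
  Rx⊆xs : filter (R? x) xs ⊆ xs
  Rx⊆xs = filter-⊆ (R? x) xs
... | inj₂ enough = Sum.map (homogeneous-skip ¬Rx⊆xs) (homogeneous-cons ¬Rx⊆xs (all-filter _ xs))
                            (ramsey₂ R? (suc a) b _ enough)
  where
  ¬Rx⊆xs : filter (λ y → ¬? (R? x y)) xs ⊆ xs
  ¬Rx⊆xs = filter-⊆ (λ y → ¬? (R? x y)) xs

Fin1-unique : (i : Fin 1) → i ≡ zero
Fin1-unique zero = refl

squashZero : ∀ {r} → Fin (suc (suc r)) → Fin (suc r)
squashZero zero = zero
squashZero (suc k) = k

squashZero-≢zero : ∀ {r} {k : Fin (suc (suc r))} {j} → k ≢ zero → squashZero k ≡ j → k ≡ suc j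
squashZero-≢zero {k = zero} k≢0 _ = ⊥-elim (k≢0 refl)
squashZero-≢zero {k = suc k} _ refl = refl

ramsey : ∀ r n → ∃ λ N → ∀ {A : Set} (c : A → A → Fin (suc r)) xs → N ≤ length xs →
         ∃ λ k → HomogeneousSublist (λ x y → c x y ≡ k) n xs
ramsey zero n = n , λ c xs n≤ → zero , xs , ⊆-refl , n≤ , AllPairs-universal (λ x y → Fin1-unique (c x y)) xs
ramsey (suc r) n with ramsey r n
... | N , homogeneous = ramseyBound n N , go
  where
  go : ∀ {A : Set} (c : A → A → Fin (suc (suc r))) xs → ramseyBound n N ≤ length xs →
       ∃ λ k → HomogeneousSublist (λ x y → c x y ≡ k) n xs
  go c xs bound≤ with ramsey₂ (λ x y → c x y Fin.≟ zero) n N xs bound≤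
  ... | inj₁ zero-coloured = zero , zero-coloured
  ... | inj₂ (ys , ys⊆xs , N≤ , nonzero)
    with homogeneous (λ x y → squashZero (c x y)) ys N≤
  ...  | k , zs , zs⊆ys , n≤ , squashed =
    suc k , zs , ⊆-trans zs⊆ys ys⊆xs , n≤ ,
    AllPairs.zipWith (λ (≢0 , ≡k) → squashZero-≢zero ≢0 ≡k) (AllPairs-resp-⊆ zs⊆ys nonzero , squashed)

Increasing : ∀ {n N} → (Fin n → Fin N) → Set
Increasing f = f Preserves Fin._<_ ⟶ Fin._<_

Monochromatic : ∀ {n N r} → (Fin N → Fin N → Fin r) → (Fin n → Fin N) → Fin r → Set
Monochromatic c f k = ∀ {i j} → i Fin.< j → c (f i) (f j) ≡ k

increasing-injective : ∀ {n N} {f : Fin n → Fin N} → Increasing f → Injective _≡_ _≡_ f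
increasing-injective f-inc {i} {j} fi≡fj with Finₚ.<-cmp i j
... | tri< i<j _ _ = ⊥-elim (Finₚ.<-irrefl fi≡fj (f-inc i<j))
... | tri≈ _ i≡j _ = i≡j
... | tri> _ _ j<i = ⊥-elim (Finₚ.<-irrefl (sym fi≡fj) (f-inc j<i))

inject≤-increasing : ∀ {m n} .(m≤n : m ≤ n) → Increasing (λ (i : Fin m) → inject≤ i m≤n)
inject≤-increasing m≤n {i} {j} = subst₂ _<_ (sym (toℕ-inject≤ i m≤n)) (sym (toℕ-inject≤ j m≤n))

ramsey-increasing : ∀ r .{{_ : NonZero r}} n →
                    ∃ λ N → ∀ {M} → N ≤ M → (c : Fin M → Fin M → Fin r) →
                    ∃₂ λ (f : Fin n → Fin M) k → Increasing f × Monochromatic c f k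
ramsey-increasing (suc r) n with ramsey r n
... | N , homogeneous = N , go
  where
  go : ∀ {M} → N ≤ M → (c : Fin M → Fin M → Fin (suc r)) →
       ∃₂ λ (f : Fin n → Fin M) k → Increasing f × Monochromatic c f k
  go {M} N≤M c with homogeneous c (allFin M) (subst (N ≤_) (sym (length-tabulate id)) N≤M)
  ... | k , ys , ys⊆ , n≤ , mono =
    f , k , (λ i<j → proj₁ (f-pairs i<j)) , (λ i<j → proj₂ (f-pairs i<j))
    where
    pairs : AllPairs (λ a b → a Fin.< b × c a b ≡ k) ys
    pairs = AllPairs.zip (AllPairs-resp-⊆ ys⊆ (tabulate⁺-< id) , mono)
    f : Fin n → Fin M
    f i = List.lookup ys (inject≤ i n≤)
    f-pairs : ∀ {i j} → i Fin.< j → f i Fin.< f j × c (f i) (f j) ≡ k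
    f-pairs i<j = AllPairs-lookup pairs (inject≤-increasing n≤ i<j)

-- The product Ramsey theorem

GridColouring : ℕ → ℕ → ℕ → Set
GridColouring N d r = Vec (Fin N) d → Vec (Fin N) d → Fin r

colouringCount : ℕ → ℕ → ℕ → ℕ
colouringCount N d r = (r ^ (N ^ d)) ^ (N ^ d)

colouringCount-nonZero : ∀ N d r .{{_ : NonZero r}} → NonZero (colouringCount N d r)
colouringCount-nonZero N d r = m^n≢0 (r ^ (N ^ d)) (N ^ d) {{m^n≢0 r (N ^ d)}}

ColouringCode : ℕ → ℕ → ℕ → Set
ColouringCode N d r = Fin (colouringCount N d r)

module _ {N d : ℕ} where

  encodeGrid : Vec (Fin N) d → Fin (N ^ d)
  encodeGrid v = funToFin (Vec.lookup v)

  decodeGrid : Fin (N ^ d) → Vec (Fin N) d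
  decodeGrid w = Vec.tabulate (finToFun w)

  decodeGrid-encodeGrid : ∀ v → decodeGrid (encodeGrid v) ≡ v
  decodeGrid-encodeGrid v = trans (tabulate-cong (finToFun-funToFin (Vec.lookup v))) (tabulate∘lookup v)

  encodeColouring : ∀ {r} → GridColouring N d r → ColouringCode N d r
  encodeColouring χ = funToFin (λ p → funToFin (λ q → χ (decodeGrid p) (decodeGrid q)))

  decodeColouring : ∀ {r} → ColouringCode N d r → GridColouring N d r
  decodeColouring K u v = finToFun (finToFun K (encodeGrid u)) (encodeGrid v)

  decodeColouring-encodeColouring : ∀ {r} (χ : GridColouring N d r) u v →
                                    decodeColouring (encodeColouring χ) u v ≡ χ u v
  decodeColouring-encodeColouring χ u v = begin
    finToFun (finToFun (encodeColouring χ) (encodeGrid u)) (encodeGrid v)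
      ≡⟨ cong (λ K → finToFun K (encodeGrid v)) (finToFun-funToFin _ (encodeGrid u)) ⟩
    finToFun (funToFin (λ q → χ (decodeGrid (encodeGrid u)) (decodeGrid q))) (encodeGrid v)
      ≡⟨ finToFun-funToFin _ (encodeGrid v) ⟩
    χ (decodeGrid (encodeGrid u)) (decodeGrid (encodeGrid v))
      ≡⟨ cong₂ χ (decodeGrid-encodeGrid u) (decodeGrid-encodeGrid v) ⟩
    χ u v ∎
    where open ≡-Reasoning

productMap : ∀ {d n N} → (Fin d → Fin n → Fin N) → Vec (Fin n) d → Vec (Fin N) d
productMap F s = Vec.tabulate (λ i → F i (Vec.lookup s i))

productRamsey : ∀ d r .{{_ : NonZero r}} n → ∃ λ N → (χ : GridColouring N d r) →
  ∃₂ λ (F : Fin d → Fin n → Fin N) k → (∀ i → Increasing (F i)) ×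
    (∀ {s t} → Pointwise Fin._<_ s t → χ (productMap F s) (productMap F t) ≡ k)
productRamsey zero r n = 0 , λ χ → (λ ()) , χ [] [] , (λ ()) , λ { [] → refl }
productRamsey (suc d) r n with productRamsey d r n
... | N′ , productRamsey′
  with ramsey-increasing (colouringCount N′ d r) {{colouringCount-nonZero N′ d r}} n
... | N₀ , ramsey₀ = N₀ ⊔ N′ , go
  where
  ι : Fin N′ → Fin (N₀ ⊔ N′)
  ι a = inject≤ a (m≤n⊔m N₀ N′)

  inducedColouring : GridColouring (N₀ ⊔ N′) (suc d) r → Fin (N₀ ⊔ N′) → Fin (N₀ ⊔ N′) → GridColouring N′ d r
  inducedColouring χ a b u v = χ (a ∷ Vec.map ι u) (b ∷ Vec.map ι v)

  -- A pair in the first coordinate is coloured by the colouring it induces on the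
  -- remaining d coordinates; there are only finitely many of those.
  colour₀ : GridColouring (N₀ ⊔ N′) (suc d) r → Fin (N₀ ⊔ N′) → Fin (N₀ ⊔ N′) → ColouringCode N′ d r
  colour₀ χ a b = encodeColouring (inducedColouring χ a b)

  go : (χ : GridColouring (N₀ ⊔ N′) (suc d) r) →
       ∃₂ λ (F : Fin (suc d) → Fin n → Fin (N₀ ⊔ N′)) k → (∀ i → Increasing (F i)) ×
         (∀ {s t} → Pointwise Fin._<_ s t → χ (productMap F s) (productMap F t) ≡ k)
  go χ with ramsey₀ (m≤m⊔n N₀ N′) (colour₀ χ)
  ... | f₀ , K , f₀-increasing , f₀-monochromatic with productRamsey′ (decodeColouring K)
  ... | F′ , k , F′-increasing , F′-monochromatic = F , k , F-increasing , F-monochromatic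
    where
    F : Fin (suc d) → Fin n → Fin (N₀ ⊔ N′)
    F zero = f₀
    F (suc i) = ι ∘ F′ i

    F-increasing : ∀ i → Increasing (F i)
    F-increasing zero = f₀-increasing
    F-increasing (suc i) = inject≤-increasing (m≤n⊔m N₀ N′) ∘ F′-increasing i

    F-monochromatic : ∀ {s t} → Pointwise Fin._<_ s t → χ (productMap F s) (productMap F t) ≡ k
    F-monochromatic {s₀ ∷ s} {t₀ ∷ t} (s₀<t₀ ∷ s<t) = begin
      χ (f₀ s₀ ∷ Vec.tabulate (ι ∘ G s)) (f₀ t₀ ∷ Vec.tabulate (ι ∘ G t))
        ≡⟨ cong₂ (λ u v → χ (f₀ s₀ ∷ u) (f₀ t₀ ∷ v)) (tabulate-∘ ι (G s)) (tabulate-∘ ι (G t)) ⟩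
      χ (f₀ s₀ ∷ Vec.map ι (productMap F′ s)) (f₀ t₀ ∷ Vec.map ι (productMap F′ t))
        ≡⟨ decodeColouring-encodeColouring (inducedColouring χ (f₀ s₀) (f₀ t₀)) _ _ ⟨
      decodeColouring (colour₀ χ (f₀ s₀) (f₀ t₀)) (productMap F′ s) (productMap F′ t)
        ≡⟨ cong (λ K′ → decodeColouring K′ (productMap F′ s) (productMap F′ t))
                (f₀-monochromatic s₀<t₀) ⟩
      decodeColouring K (productMap F′ s) (productMap F′ t)
        ≡⟨ F′-monochromatic s<t ⟩
      k ∎
      where
      open ≡-Reasoning
      G : Vec (Fin n) d → Fin d → Fin N′
      G s i = F′ i (Vec.lookup s i)

-- Realizers and grids

realizedPoset : ∀ {m d} → (Fin (suc d) → LinearOrder m) → FinPoset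
realizedPoset {m} L = record
  { size = m
  ; _≺_ = _≺ᴸ_
  ; isSPO = record
    { isEquivalence = isEquivalence
    ; irrefl = λ { refl x≺x → <-irrefl refl (x≺x zero) }
    ; trans = λ x≺y y≺z i → <-trans (x≺y i) (y≺z i)
    ; <-resp-≈ = resp₂ _≺ᴸ_
    }
  }
  where
  _≺ᴸ_ : Fin m → Fin m → Set
  x ≺ᴸ y = ∀ i → proj₁ (L i) x < proj₁ (L i) y

realizedPoset-dimension : ∀ {m d} (L : Fin (suc d) → LinearOrder m) → DimAtMost (suc d) (realizedPoset L)
realizedPoset-dimension L = L , λ x y → mk⇔ id id

∃-upper-bound : ∀ {k} (f : Fin k → ℕ) → ∃ λ b → ∀ x → f x < b
∃-upper-bound {zero} f = 0 , λ ()
∃-upper-bound {suc k} f with ∃-upper-bound (f ∘ suc)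
... | b , f∘suc<b = suc (f zero) ⊔ b , λ where
  zero → m≤m⊔n (suc (f zero)) b
  (suc x) → <-≤-trans (f∘suc<b x) (m≤n⊔m (suc (f zero)) b)

DimAtMost⇒finRealizer : ∀ {d} (P : FinPoset) → DimAtMost d P →
  ∃₂ λ n (ρ : Fin d → Fin (size P) → Fin n) → (∀ i → Injective _≡_ _≡_ (ρ i)) ×
    (∀ x y → _≺_ P x y ⇔ (∀ i → ρ i x Fin.< ρ i y))
DimAtMost⇒finRealizer {d} P (L , realizes) = n , ρ , ρ-injective , ρ-realizes
  where
  rank : Fin d → Fin (size P) → ℕ
  rank i = proj₁ (L i)

  bound : Fin d → ℕ
  bound i = proj₁ (∃-upper-bound (rank i))

  n : ℕ
  n = proj₁ (∃-upper-bound bound)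

  rank<n : ∀ i x → rank i x < n
  rank<n i x = <-trans (proj₂ (∃-upper-bound (rank i)) x) (proj₂ (∃-upper-bound bound) i)

  ρ : Fin d → Fin (size P) → Fin n
  ρ i x = fromℕ< (rank<n i x)

  toℕ-ρ : ∀ i x → toℕ (ρ i x) ≡ rank i x
  toℕ-ρ i x = toℕ-fromℕ< (rank<n i x)

  ρ-injective : ∀ i → Injective _≡_ _≡_ (ρ i)
  ρ-injective i {x} {y} ρx≡ρy =
    proj₂ (L i) (trans (sym (toℕ-ρ i x)) (trans (cong toℕ ρx≡ρy) (toℕ-ρ i y)))

  ρ-realizes : ∀ x y → _≺_ P x y ⇔ (∀ i → ρ i x Fin.< ρ i y)
  ρ-realizes x y = mk⇔
    (λ x≺y i → subst₂ _<_ (sym (toℕ-ρ i x)) (sym (toℕ-ρ i y)) (Equivalence.to (realizes x y) x≺y i))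
    (λ ρ< → Equivalence.from (realizes x y) λ i → subst₂ _<_ (toℕ-ρ i x) (toℕ-ρ i y) (ρ< i))

-- Lexicographic in (wᵢ , w): a linear order on the grid extending the i-th coordinate order.
gridRank : ∀ N {d} → Fin d → Fin (N ^ d) → ℕ
gridRank N i w = toℕ (combine (finToFun {N} w i) w)

gridOrder : ∀ N {d} → Fin d → LinearOrder (N ^ d)
gridOrder N i = gridRank N i , λ rank≡ → combine-injectiveʳ {N} _ _ _ _ (toℕ-injective rank≡)

gridRank-mono : ∀ N {d} (i : Fin d) {w w′ : Fin (N ^ d)} →
                finToFun {N} w i Fin.< finToFun {N} w′ i → gridRank N i w < gridRank N i w′
gridRank-mono N i {w} {w′} = combine-monoˡ-< w w′

module GridEmbedding
  {n N d} (P : FinPoset) (ρ : Fin (suc d) → Fin (size P) → Fin n)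
  (ρ-injective : ∀ i → Injective _≡_ _≡_ (ρ i))
  (ρ-realizes : ∀ x y → _≺_ P x y ⇔ (∀ i → ρ i x Fin.< ρ i y))
  (F : Fin (suc d) → Fin n → Fin N) (F-increasing : ∀ i → Increasing (F i))
  where

  point : Fin (size P) → Vec (Fin n) (suc d)
  point x = Vec.tabulate (λ i → ρ i x)

  embed : Fin (size P) → Fin (N ^ suc d)
  embed x = encodeGrid (productMap F (point x))

  embed-coordinate : ∀ x i → finToFun {N} (embed x) i ≡ F i (ρ i x)
  embed-coordinate x i = begin
    finToFun {N} (embed x) i               ≡⟨ finToFun-funToFin (Vec.lookup (productMap F (point x))) i ⟩
    Vec.lookup (productMap F (point x)) i  ≡⟨ lookup∘tabulate (λ j → F j (Vec.lookup (point x) j)) i ⟩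
    F i (Vec.lookup (point x) i)           ≡⟨ cong (F i) (lookup∘tabulate (λ j → ρ j x) i) ⟩
    F i (ρ i x)                            ∎
    where open ≡-Reasoning

  embed-injective : Injective _≡_ _≡_ embed
  embed-injective {x} {y} embed≡ = ρ-injective zero (increasing-injective (F-increasing zero) (begin
    F zero (ρ zero x)                    ≡⟨ embed-coordinate x zero ⟨
    finToFun {N} {suc d} (embed x) zero  ≡⟨ cong (λ w → finToFun {N} {suc d} w zero) embed≡ ⟩
    finToFun {N} {suc d} (embed y) zero  ≡⟨ embed-coordinate y zero ⟩
    F zero (ρ zero y)                    ∎))
    where open ≡-Reasoning

  embed-mono : ∀ {x y} i → ρ i x Fin.< ρ i y → gridRank N i (embed x) < gridRank N i (embed y)
  embed-mono {x} {y} i ρx<ρy = gridRank-mono N i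
    (subst₂ Fin._<_ (sym (embed-coordinate x i)) (sym (embed-coordinate y i)) (F-increasing i ρx<ρy))

  embed-reflects : ∀ {x y} i → gridRank N i (embed x) < gridRank N i (embed y) → ρ i x Fin.< ρ i y
  embed-reflects {x} {y} i rank< with Finₚ.<-cmp (ρ i x) (ρ i y)
  ... | tri< ρx<ρy _ _ = ρx<ρy
  ... | tri≈ _ ρx≡ρy _ = ⊥-elim (<-irrefl (cong (gridRank N i ∘ embed) (ρ-injective i ρx≡ρy)) rank<)
  ... | tri> _ _ ρy<ρx = ⊥-elim (<-asym rank< (embed-mono i ρy<ρx))

  embedding : Embedding P (realizedPoset (gridOrder N {suc d}))
  embedding = embed , embed-injective , λ x y → mk⇔
    (λ x≺y i → embed-mono i (Equivalence.to (ρ-realizes x y) x≺y i))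
    (λ rank< → Equivalence.from (ρ-realizes x y) (λ i → embed-reflects i (rank< i)))

corollary5p4 : (d : ℕ) → 0 < d → RamseyProperty (DimAtMost d)
corollary5p4 (suc d) _ P dimP r 0<r with DimAtMost⇒finRealizer P dimP
... | n , ρ , ρ-injective , ρ-realizes with productRamsey (suc d) r {{>-nonZero 0<r}} n
... | N , productRamsey′ =
  realizedPoset (gridOrder N) , realizedPoset-dimension (gridOrder N) , monochromaticCopy
  where
  monochromaticCopy : (c : Fin (N ^ suc d) → Fin (N ^ suc d) → Fin r) →
    Σ (Embedding P (realizedPoset (gridOrder N))) λ emb →
    ∃ λ k → ∀ x y → _≺_ P x y → c (proj₁ emb x) (proj₁ emb y) ≡ k
  monochromaticCopy c with productRamsey′ (λ u v → c (encodeGrid u) (encodeGrid v))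
  ... | F , k , F-increasing , F-monochromatic = embedding , k , λ x y x≺y →
    F-monochromatic (Pointwise.tabulate⁺ (Equivalence.to (ρ-realizes x y) x≺y))
    where open GridEmbedding P ρ ρ-injective ρ-realizes F F-increasing
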